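{- Let $F\colon\mathbb{B}^{2L}\to\mathbb{B}^{2L}$ be the Boolean Delta-Notch system over a graph $\mathcal{G}$ as in the context, let $x=(n,\bar{n})\in\mathbb{B}^{2L}$ be a fixed point of $F$ (so $n\in\mathbb{B}^L$ and $\bar n_i=1-n_i$), and let $H\subseteq C$. Define $H_0=\{i\in H: n_i=0\}$, $H_1=\{i\in H: n_i=1\}$, $K=\{j\in S(H_1)\setminus H: n_j=0\}$, $J=\{j\in S(K\cup H_0)\setminus H: n_h=1 \text{ for all } h\in S(j)\setminus(K\cup H_0)\}$ and $I=H\cup K\cup J$. Then $x[I\cup(I+L)]$ is the minimal (for inclusion) trap space for $F$ containing $x[H\cup(H+L)]$.
   Context: Let $L\ge 1$ and let $\mathcal{G}$ be an undirected connected graph without loops on the vertex set $C=\{1,\dots,L\}$. For $i\in C$ let $S(i)$ be the set of neighbours of $i$ in $\mathcal{G}$, and for $A\subseteq C$ let $S(A)=\bigcup_{i\in A}S(i)$; $A+L=\{i+L:i\in A\}$. $\mathbb{B}=\{0,1\}$. The Boolean Delta-Notch system is $F\colon\mathbb{B}^{2L}\to\mathbb{B}^{2L}$, writing states as $(n,d)=(n_1,\dots,n_L,d_1,\dots,d_L)$, with $F_i(n,d)=\bigvee_{j\in S(i)}d_j$ (empty disjunction $=0$) and $F_{i+L}(n,d)=1-n_i$. $AD_F$ has an edge from $y$ to the state obtained by flipping coordinate $i$ whenever $F_i(y)\neq y_i$. For $y\in\mathbb{B}^{2L}$, $I\subseteq\{1,\dots,2L\}$, the subspace $y[I]$ is $\{z: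 z_i=y_i\ \forall i\notin I\}$. A trap space is a subspace such that every successor in $AD_F$ of its states lies in it. -}

module Defs where

open import Data.Nat using (ℕ; _≤_)
open import Data.Fin using (Fin)
open import Data.Bool using (Bool; true; false; not; _∧_; _∨_)
open import Data.Sum using (_⊎_; inj₁; inj₂)
open import Data.Product using (Σ; _×_)
open import Data.List using (allFin)
open import Data.Bool.ListAction using (any; all)
open import Relation.Binary.PropositionalEquality using (_≡_; _≢_)

-- Coordinates of B^{2L}: inj₁ i is coordinate i (the n_i), inj₂ i is coordinate i+L (the d_i).
Coord : ℕ → Set
Coord L = Fin L ⊎ Fin L

State : ℕ → Set
State L = Coord L → Bool

Subset : ℕ → Set
Subset L = Fin L → Bool

CSubset : ℕ → Set
CSubset L = Coord L → Bool

data Reach {L : ℕ} (adj : Fin L → Fin L → Bool) : Fin L → Fin L → Set where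
  here : ∀ {i} → Reach adj i i
  step : ∀ {i j k} → adj i j ≡ true → Reach adj j k → Reach adj i k

record Graph (L : ℕ) : Set where
  field
    adj       : Fin L → Fin L → Bool
    symmetric : ∀ i j → adj i j ≡ adj j i
    loopless  : ∀ i → adj i i ≡ false
    connected : ∀ i j → Reach adj i j
open Graph public

S : ∀ {L} → Graph L → Subset L → Subset L
S {L} G A j = any (λ i → A i ∧ adj G i j) (allFin L)

_∪_ : ∀ {L} → Subset L → Subset L → Subset L
(A ∪ B) i = A i ∨ B i

doubled : ∀ {L} → Subset L → CSubset L
doubled A (inj₁ i) = A i
doubled A (inj₂ i) = A i

F : ∀ {L} → Graph L → State L → State L
F {L} G y (inj₁ i) = any (λ j → adj G i j ∧ y (inj₂ j)) (allFin L)
F {L} G y (inj₂ i) = not (y (inj₁ i))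

IsFixedPoint : ∀ {L} → Graph L → State L → Set
IsFixedPoint G x = ∀ c → F G x c ≡ x c

Edge : ∀ {L} → Graph L → State L → State L → Set
Edge {L} G y z = Σ (Coord L) λ c →
  (F G y c ≢ y c) × (z c ≡ not (y c)) × (∀ c' → c' ≢ c → z c' ≡ y c')

_∈[_,_] : ∀ {L} → State L → State L → CSubset L → Set
z ∈[ y , I ] = ∀ c → I c ≡ false → z c ≡ y c

IsTrapSpace : ∀ {L} → Graph L → State L → CSubset L → Set
IsTrapSpace {L} G y I = ∀ (z z' : State L) → z ∈[ y , I ] → Edge G z z' → z' ∈[ y , I ]

_⊆ₛ_ : ∀ {L} → (State L × CSubset L) → (State L × CSubset L) → Set
_⊆ₛ_ {L} (y Data.Product., I) (y' Data.Product., I') = ∀ (z : State L) → z ∈[ y , I ] → z ∈[ y' , I' ]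

module Construction {L : ℕ} (G : Graph L) (x : State L) (H : Subset L) where
  n : Subset L
  n i = x (inj₁ i)

  H₀ H₁ K KH₀ J I : Subset L
  H₀ i = H i ∧ not (n i)
  H₁ i = H i ∧ n i
  K j = S G H₁ j ∧ not (H j) ∧ not (n j)
  KH₀ = K ∪ H₀
  -- n_h = 1 for all h ∈ S(j) \ (K ∪ H₀)
  J j = S G KH₀ j ∧ not (H j) ∧ all (λ h → not (adj G j h ∧ not (KH₀ h)) ∨ n h) (allFin L)
  I = H ∪ (K ∪ J)

-- Off I the fixed point sustains itself: for i ∉ I with n_i = 0 no neighbour of i lies in I,
-- and for i ∉ I with n_i = 1 some neighbour h ∉ I has n_h = 0. So on x[I ∪ (I+L)] the update
-- function agrees with x at every fixed coordinate, and the subspace is a trap space.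
-- Conversely, a trap space y[I'] containing x[H ∪ (H+L)] has H ∪ (H+L) among its free
-- coordinates and is closed under moves. Raising d_h for h ∈ H₁ makes every n_k with k ∈ K
-- unstable, and lowering d_h for h ∈ K ∪ H₀ makes every n_j with j ∈ J unstable; once n_i
-- has flipped, d_i is unstable as well. Hence I ∪ (I+L) ⊆ I'.

module Submission where

open import Defs
open import Data.Nat using (ℕ; _≤_)
open import Data.Fin using (Fin)
open import Data.Fin.Properties using () renaming (_≟_ to _≟ᶠ_)
open import Data.Sum using (_⊎_; inj₁; inj₂; [_,_]; map₂)
open import Data.Sum.Properties using (≡-dec)
open import Data.Product using (_×_; _,_; proj₁; proj₂; ∃-syntax)
open import Data.Bool using (Bool; true; false; not; _∧_; _∨_; if_then_else_) renaming (_≟_ to _≟ᵇ_)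
open import Data.Bool.Properties using (∨-zeroʳ; not-¬; ¬-not; not-injective)
open import Data.Bool.ListAction using (any; all)
open import Data.List using ([]; _∷_; allFin)
open import Data.List.Relation.Unary.Any using (here; there)
open import Data.List.Membership.Propositional using (_∈_)
open import Data.List.Membership.Propositional.Properties using (∈-allFin)
open import Data.Empty using (⊥; ⊥-elim)
open import Function using (_∘_)
open import Relation.Nullary using (Dec; yes; no)
open import Relation.Binary.PropositionalEquality using (_≡_; _≢_; refl; sym; trans; cong; module ≡-Reasoning)

∧-true⁻ : ∀ {a b} → a ∧ b ≡ true → a ≡ true × b ≡ true
∧-true⁻ {true} b≡true = refl , b≡true

∧-true⁺ : ∀ {a b} → a ≡ true → b ≡ true → a ∧ b ≡ true
∧-true⁺ refl refl = refl

∨-true⁻ : ∀ {a b} → a ∨ b ≡ true → a ≡ true ⊎ b ≡ true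
∨-true⁻ {true}  _      = inj₁ refl
∨-true⁻ {false} b≡true = inj₂ b≡true

∨-true⁺ʳ : ∀ a {b} → b ≡ true → a ∨ b ≡ true
∨-true⁺ʳ a refl = ∨-zeroʳ a

module _ {A : Set} (p : A → Bool) where

  any-witness : ∀ xs → any p xs ≡ true → ∃[ a ] p a ≡ true
  any-witness (a ∷ xs) any≡true with p a in pa
  ... | true  = a , pa
  ... | false = any-witness xs any≡true

  any-intro : ∀ {a xs} → a ∈ xs → p a ≡ true → any p xs ≡ true
  any-intro (here refl) pa rewrite pa = refl
  any-intro {xs = b ∷ _} (there a∈xs) pa = ∨-true⁺ʳ (p b) (any-intro a∈xs pa)

  any-false : ∀ xs → (∀ a → p a ≡ false) → any p xs ≡ false
  any-false []       _      = refl
  any-false (a ∷ xs) p≡false rewrite p≡false a = any-false xs p≡false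

  all-elim : ∀ {a xs} → a ∈ xs → all p xs ≡ true → p a ≡ true
  all-elim (here refl)  all≡true = proj₁ (∧-true⁻ all≡true)
  all-elim {xs = b ∷ _} (there a∈xs) all≡true = all-elim a∈xs (proj₂ (∧-true⁻ {p b} all≡true))

  all-witness : ∀ xs → all p xs ≡ false → ∃[ a ] p a ≡ false
  all-witness (a ∷ xs) all≡false with p a in pa
  ... | false = a , pa
  ... | true  = all-witness xs all≡false

_⊆ᵇ_ : {X : Set} → (X → Bool) → (X → Bool) → Set
A ⊆ᵇ B = ∀ c → A c ≡ true → B c ≡ true

module _ {X : Set} {A B : X → Bool} where

  ⊆ᵇ-false : A ⊆ᵇ B → ∀ {c} → B c ≡ false → A c ≡ false
  ⊆ᵇ-false A⊆B {c} Bc = ¬-not λ Ac → not-¬ (A⊆B c Ac) Bc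

  ⊆ᵇ-trans : ∀ {C : X → Bool} → A ⊆ᵇ B → B ⊆ᵇ C → A ⊆ᵇ C
  ⊆ᵇ-trans A⊆B B⊆C c Ac = B⊆C c (A⊆B c Ac)

module _ {L : ℕ} {A B : Subset L} where

  ∪-⊆ᵇˡ : A ⊆ᵇ (A ∪ B)
  ∪-⊆ᵇˡ c Ac rewrite Ac = refl

  ∪-⊆ᵇʳ : B ⊆ᵇ (A ∪ B)
  ∪-⊆ᵇʳ c = ∨-true⁺ʳ (A c)

  ∪-⊆ᵇ : ∀ {C} → A ⊆ᵇ C → B ⊆ᵇ C → (A ∪ B) ⊆ᵇ C
  ∪-⊆ᵇ A⊆C B⊆C c e = [ A⊆C c , B⊆C c ] (∨-true⁻ {A c} e)

module _ {L : ℕ} {A : Subset L} {D : CSubset L} where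

  doubled-⊆ᵇ : (∀ i → A i ≡ true → D (inj₁ i) ≡ true × D (inj₂ i) ≡ true) →
               doubled A ⊆ᵇ D
  doubled-⊆ᵇ both (inj₁ i) Ai = proj₁ (both i Ai)
  doubled-⊆ᵇ both (inj₂ i) Ai = proj₂ (both i Ai)

  doubled-∪-⊆ᵇ : ∀ {B} → doubled A ⊆ᵇ D → doubled B ⊆ᵇ D → doubled (A ∪ B) ⊆ᵇ D
  doubled-∪-⊆ᵇ A⊆D B⊆D (inj₁ i) e = [ A⊆D (inj₁ i) , B⊆D (inj₁ i) ] (∨-true⁻ {A i} e)
  doubled-∪-⊆ᵇ A⊆D B⊆D (inj₂ i) e = [ A⊆D (inj₂ i) , B⊆D (inj₂ i) ] (∨-true⁻ {A i} e)

module _ {L : ℕ} where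

  _≟ᶜ_ : (c c' : Coord L) → Dec (c ≡ c')
  _≟ᶜ_ = ≡-dec _≟ᶠ_ _≟ᶠ_

  flip : State L → Coord L → State L
  flip z c c' with c' ≟ᶜ c
  ... | yes _ = not (z c)
  ... | no  _ = z c'

  flip-at : ∀ z c → flip z c c ≡ not (z c)
  flip-at z c with c ≟ᶜ c
  ... | yes _   = refl
  ... | no  c≢c = ⊥-elim (c≢c refl)

  flip-off : ∀ z c c' → c' ≢ c → flip z c c' ≡ z c'
  flip-off z c c' c'≢c with c' ≟ᶜ c
  ... | yes c'≡c = ⊥-elim (c'≢c c'≡c)
  ... | no  _    = refl

  setᵈ : State L → Subset L → Bool → State L
  setᵈ z A b (inj₁ i) = z (inj₁ i)
  setᵈ z A b (inj₂ i) = if A i then b else z (inj₂ i)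

  setᵈ-inside : ∀ z A b {i} → A i ≡ true → setᵈ z A b (inj₂ i) ≡ b
  setᵈ-inside z A b Ai rewrite Ai = refl

  setᵈ-outside : ∀ z A b {i} → A i ≡ false → setᵈ z A b (inj₂ i) ≡ z (inj₂ i)
  setᵈ-outside z A b Ai rewrite Ai = refl

  setᵈ-∈ : ∀ z A {B} b → A ⊆ᵇ B → setᵈ z A b ∈[ z , doubled B ]
  setᵈ-∈ z A b A⊆B (inj₁ i) _  = refl
  setᵈ-∈ z A b A⊆B (inj₂ i) Bi = setᵈ-outside z A b (⊆ᵇ-false {A = A} A⊆B Bi)

  ⊆ₛ⇒⊆ᵇ : ∀ {x y : State L} {A D} → (x , A) ⊆ₛ (y , D) → A ⊆ᵇ D
  ⊆ₛ⇒⊆ᵇ {x} {y} {A} {D} sub c Ac = ¬-not λ Dc → not-¬ refl (begin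
      x c             ≡⟨ sub x (λ _ _ → refl) c Dc ⟩
      y c             ≡⟨ sub (flip x c) flip∈ c Dc ⟨
      flip x c c      ≡⟨ flip-at x c ⟩
      not (x c)       ∎)
    where
    open ≡-Reasoning
    flip∈ : flip x c ∈[ x , A ]
    flip∈ c' Ac' = flip-off x c c' λ { refl → not-¬ Ac Ac' }

  ⊆ᵇ⇒⊆ₛ : ∀ {x y : State L} {A D} → x ∈[ y , D ] → A ⊆ᵇ D → (x , A) ⊆ₛ (y , D)
  ⊆ᵇ⇒⊆ₛ {A = A} x∈ A⊆D z z∈ c Dc = trans (z∈ c (⊆ᵇ-false {A = A} A⊆D Dc)) (x∈ c Dc)

module _ {L : ℕ} (G : Graph L) where

  flip-edge : ∀ z c → F G z c ≢ z c → Edge G z (flip z c)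
  flip-edge z c moves = c , moves , flip-at z c , flip-off z c

  frozen⇒trap : ∀ {y D} → (∀ z → z ∈[ y , D ] → ∀ c → D c ≡ false → F G z c ≡ z c) →
                IsTrapSpace G y D
  frozen⇒trap frozen z z' z∈ (c , moves , _ , unchanged) c' Dc' with c' ≟ᶜ c
  ... | yes refl = ⊥-elim (moves (frozen z z∈ c Dc'))
  ... | no c'≢c  = trans (unchanged c' c'≢c) (z∈ c' Dc')

  trap⇒frozen : ∀ {y D z c} → IsTrapSpace G y D → z ∈[ y , D ] → D c ≡ false → F G z c ≡ z c
  trap⇒frozen {y} {D} {z} {c} trap z∈ Dc with F G z c ≟ᵇ z c
  ... | yes frozen = frozen
  ... | no  moves  = ⊥-elim (not-¬ refl (begin
      z c         ≡⟨ z∈ c Dc ⟩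
      y c         ≡⟨ trap z (flip z c) z∈ (flip-edge z c moves) c Dc ⟨
      flip z c c  ≡⟨ flip-at z c ⟩
      not (z c)   ∎))
    where open ≡-Reasoning

  trap-active-n : ∀ {y D z i} → IsTrapSpace G y D → z ∈[ y , D ] →
                  F G z (inj₁ i) ≢ z (inj₁ i) → z (inj₂ i) ≡ not (z (inj₁ i)) →
                  D (inj₁ i) ≡ true × D (inj₂ i) ≡ true
  trap-active-n {y} {D} {z} {i} trap z∈ moves d≡¬n =
    ¬-not (λ Dn → moves (trap⇒frozen trap z∈ Dn)) ,
    ¬-not (λ Dd → not-¬ refl (sym (begin
      not (not (z (inj₁ i)))  ≡⟨ cong not (flip-at z (inj₁ i)) ⟨
      not (w (inj₁ i))        ≡⟨ trap⇒frozen trap w∈ Dd ⟩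
      w (inj₂ i)              ≡⟨ flip-off z (inj₁ i) (inj₂ i) (λ ()) ⟩
      z (inj₂ i)              ≡⟨ d≡¬n ⟩
      not (z (inj₁ i))        ∎)))
    where
    open ≡-Reasoning
    w = flip z (inj₁ i)
    w∈ : w ∈[ y , D ]
    w∈ = trap z w z∈ (flip-edge z (inj₁ i) moves)

module _ {L : ℕ} {G : Graph L} {x : State L} (fp : IsFixedPoint G x) where

  fixed-d : ∀ i → x (inj₂ i) ≡ not (x (inj₁ i))
  fixed-d i = sym (fp (inj₂ i))

  neighbour-n-false⇒n-true : ∀ {i j} → adj G i j ≡ true → x (inj₁ j) ≡ false → x (inj₁ i) ≡ true
  neighbour-n-false⇒n-true {i} {j} aij nj = trans (sym (fp (inj₁ i)))
    (any-intro (λ j → adj G i j ∧ x (inj₂ j)) (∈-allFin j) (∧-true⁺ aij (trans (fixed-d j) (cong not nj))))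

  n-true⇒neighbour-n-false : ∀ {i} → x (inj₁ i) ≡ true → ∃[ j ] adj G i j ≡ true × x (inj₁ j) ≡ false
  n-true⇒neighbour-n-false {i} ni
    with j , aij∧dj ← any-witness (λ j → adj G i j ∧ x (inj₂ j)) (allFin L) (trans (fp (inj₁ i)) ni)
    with aij , dj ← ∧-true⁻ aij∧dj
    = j , aij , not-injective (trans (sym (fixed-d j)) dj)

  n-false⇒neighbour-n-true : ∀ {i j} → x (inj₁ i) ≡ false → adj G i j ≡ true → x (inj₁ j) ≡ true
  n-false⇒neighbour-n-true ni aij = ¬-not λ nj → not-¬ (neighbour-n-false⇒n-true aij nj) ni

module _ {L : ℕ} {G : Graph L} {x : State L} (fp : IsFixedPoint G x) (H : Subset L) where
  open Construction G x H

  J-condition : Fin L → Fin L → Bool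
  J-condition j h = not (adj G j h ∧ not (KH₀ h)) ∨ n h

  J-condition⁻ : ∀ {j h} → J-condition j h ≡ true → adj G j h ≡ true → KH₀ h ≡ true ⊎ n h ≡ true
  J-condition⁻ {j} {h} = cases (adj G j h) (KH₀ h) (n h)
    where
    cases : ∀ a k m → not (a ∧ not k) ∨ m ≡ true → a ≡ true → k ≡ true ⊎ m ≡ true
    cases true true  _ _     _ = inj₁ refl
    cases true false _ holds _ = inj₂ holds

  J-condition-false⁻ : ∀ {j h} → J-condition j h ≡ false →
                       adj G j h ≡ true × KH₀ h ≡ false × n h ≡ false
  J-condition-false⁻ {j} {h} = cases (adj G j h) (KH₀ h) (n h)
    where
    cases : ∀ a k m → not (a ∧ not k) ∨ m ≡ false → a ≡ true × k ≡ false × m ≡ false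
    cases true  false false _ = refl , refl , refl
    cases false _     _     ()
    cases true  true  _     ()
    cases true  false true  ()

  K⁺ : ∀ {j} → S G H₁ j ≡ true → H j ≡ false → n j ≡ false → K j ≡ true
  K⁺ s Hj nj = ∧-true⁺ s (∧-true⁺ (cong not Hj) (cong not nj))

  K⁻ : ∀ {j} → K j ≡ true → S G H₁ j ≡ true × H j ≡ false × n j ≡ false
  K⁻ {j} kj with s , rest ← ∧-true⁻ {S G H₁ j} kj with Hj , nj ← ∧-true⁻ {not (H j)} rest
    = s , not-injective Hj , not-injective nj

  J⁺ : ∀ {j} → S G KH₀ j ≡ true → H j ≡ false → all (J-condition j) (allFin L) ≡ true → J j ≡ true
  J⁺ s Hj holds = ∧-true⁺ s (∧-true⁺ (cong not Hj) holds)

  J⁻ : ∀ {j} → J j ≡ true → S G KH₀ j ≡ true × H j ≡ false × all (J-condition j) (allFin L) ≡ true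
  J⁻ {j} jj with s , rest ← ∧-true⁻ {S G KH₀ j} jj with Hj , holds ← ∧-true⁻ {not (H j)} rest
    = s , not-injective Hj , holds

  H₀⊆H : H₀ ⊆ᵇ H
  H₀⊆H i h₀ = proj₁ (∧-true⁻ h₀)

  H₁⊆H : H₁ ⊆ᵇ H
  H₁⊆H i h₁ = proj₁ (∧-true⁻ h₁)

  H⊆I : H ⊆ᵇ I
  H⊆I = ∪-⊆ᵇˡ

  K⊆I : K ⊆ᵇ I
  K⊆I = ⊆ᵇ-trans (∪-⊆ᵇˡ {B = J}) (∪-⊆ᵇʳ {A = H})

  J⊆I : J ⊆ᵇ I
  J⊆I = ⊆ᵇ-trans (∪-⊆ᵇʳ {A = K}) (∪-⊆ᵇʳ {A = H})

  KH₀⊆I : KH₀ ⊆ᵇ I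
  KH₀⊆I = ∪-⊆ᵇ K⊆I (⊆ᵇ-trans H₀⊆H H⊆I)

  KH₀⊆H∪K : KH₀ ⊆ᵇ (H ∪ K)
  KH₀⊆H∪K = ∪-⊆ᵇ ∪-⊆ᵇʳ (⊆ᵇ-trans H₀⊆H ∪-⊆ᵇˡ)

  KH₀⇒n-false : ∀ {h} → KH₀ h ≡ true → n h ≡ false
  KH₀⇒n-false {h} kh = [ (λ k → proj₂ (proj₂ (K⁻ k))) , (λ h₀ → not-injective (proj₂ (∧-true⁻ h₀))) ]
                         (∨-true⁻ {K h} kh)

  n-true⇒¬KH₀ : ∀ {h} → n h ≡ true → KH₀ h ≡ false
  n-true⇒¬KH₀ nh = ¬-not λ kh → not-¬ nh (KH₀⇒n-false kh)

  J⇒n-true : ∀ {j} → J j ≡ true → n j ≡ true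
  J⇒n-true {j} jj
    with h , kh∧ahj ← any-witness (λ h → KH₀ h ∧ adj G h j) (allFin L) (proj₁ (J⁻ jj))
    with kh , ahj ← ∧-true⁻ kh∧ahj
    = neighbour-n-false⇒n-true fp (trans (symmetric G j h) ahj) (KH₀⇒n-false kh)

  I⁻ : ∀ {j} → I j ≡ true → H j ≡ true ⊎ K j ≡ true ⊎ J j ≡ true
  I⁻ {j} ij = map₂ (∨-true⁻ {K j}) (∨-true⁻ {H j} ij)

  I∧n-false⇒KH₀ : ∀ {j} → I j ≡ true → n j ≡ false → KH₀ j ≡ true
  I∧n-false⇒KH₀ {j} ij nj with I⁻ ij
  ... | inj₁ hj        = ∪-⊆ᵇʳ {A = K} {B = H₀} j (∧-true⁺ hj (cong not nj))
  ... | inj₂ (inj₁ kj) = ∪-⊆ᵇˡ {A = K} {B = H₀} j kj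
  ... | inj₂ (inj₂ jj) = ⊥-elim (not-¬ (J⇒n-true jj) nj)

  ¬J⇒J-condition-violated : ∀ {i} → S G KH₀ i ≡ true → H i ≡ false → J i ≡ false →
                            ∃[ h ] adj G i h ≡ true × KH₀ h ≡ false × n h ≡ false
  ¬J⇒J-condition-violated {i} s Hi Ji
    with h , violated ← all-witness (J-condition i) (allFin L) (¬-not λ holds → not-¬ (J⁺ s Hi holds) Ji)
    = h , J-condition-false⁻ violated

  outside-I-near-KH₀⇒neighbour : ∀ {i j} → I i ≡ false → adj G i j ≡ true → KH₀ j ≡ true →
                                 ∃[ h ] adj G i h ≡ true × n h ≡ false × I h ≡ false
  outside-I-near-KH₀⇒neighbour {i} {j} Ii aij kj =
    outside-I (¬J⇒J-condition-violated s-i (⊆ᵇ-false H⊆I Ii) (⊆ᵇ-false J⊆I Ii))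
    where
    s-i : S G KH₀ i ≡ true
    s-i = any-intro (λ h → KH₀ h ∧ adj G h i) (∈-allFin j) (∧-true⁺ kj (trans (symmetric G j i) aij))
    outside-I : ∃[ h ] adj G i h ≡ true × KH₀ h ≡ false × n h ≡ false →
                ∃[ h ] adj G i h ≡ true × n h ≡ false × I h ≡ false
    outside-I (h , aih , kh , nh) = h , aih , nh , ¬-not λ Ih → not-¬ (I∧n-false⇒KH₀ Ih nh) kh

  outside-I-n-true⇒neighbour : ∀ {i} → I i ≡ false → n i ≡ true →
                               ∃[ h ] adj G i h ≡ true × n h ≡ false × I h ≡ false
  outside-I-n-true⇒neighbour {i} Ii ni with j , aij , nj ← n-true⇒neighbour-n-false fp ni | I j in Ij
  ... | false = j , aij , nj , Ij
  ... | true  = outside-I-near-KH₀⇒neighbour Ii aij (I∧n-false⇒KH₀ Ij nj)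

  outside-I-n-false⇒neighbour-outside-I : ∀ {i j} → I i ≡ false → n i ≡ false → adj G i j ≡ true →
                                          I j ≡ false
  outside-I-n-false⇒neighbour-outside-I {i} {j} Ii ni aij = ¬-not (excluded ∘ I⁻)
    where
    nj = n-false⇒neighbour-n-true fp ni aij
    aji = trans (symmetric G j i) aij
    excluded : H j ≡ true ⊎ K j ≡ true ⊎ J j ≡ true → ⊥
    excluded (inj₁ hj) = not-¬ (K⊆I i (K⁺ s-i (⊆ᵇ-false H⊆I Ii) ni)) Ii
      where
      s-i : S G H₁ i ≡ true
      s-i = any-intro (λ h → H₁ h ∧ adj G h i) (∈-allFin j) (∧-true⁺ (∧-true⁺ hj nj) aji)
    excluded (inj₂ (inj₁ kj)) = not-¬ nj (proj₂ (proj₂ (K⁻ kj)))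
    excluded (inj₂ (inj₂ jj))
      with J-condition⁻ (all-elim (J-condition j) (∈-allFin i) (proj₂ (proj₂ (J⁻ jj)))) aji
    ... | inj₁ ki  = not-¬ (KH₀⊆I i ki) Ii
    ... | inj₂ ni′ = not-¬ ni′ ni

  I-frozen : ∀ z → z ∈[ x , doubled I ] → ∀ c → doubled I c ≡ false → F G z c ≡ z c
  I-frozen z z∈ (inj₂ i) Ii = begin
      not (z (inj₁ i))  ≡⟨ cong not (z∈ (inj₁ i) Ii) ⟩
      not (n i)         ≡⟨ fixed-d fp i ⟨
      x (inj₂ i)        ≡⟨ z∈ (inj₂ i) Ii ⟨
      z (inj₂ i)        ∎
    where open ≡-Reasoning
  I-frozen z z∈ (inj₁ i) Ii = trans (F≡ (n i) refl) (sym (z∈ (inj₁ i) Ii))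
    where
    F≡ : ∀ b → n i ≡ b → F G z (inj₁ i) ≡ b
    F≡ true ni with h , aih , nh , Ih ← outside-I-n-true⇒neighbour Ii ni
      = any-intro (λ j → adj G i j ∧ z (inj₂ j)) (∈-allFin h)
                  (∧-true⁺ aih (trans (z∈ (inj₂ h) Ih) (trans (fixed-d fp h) (cong not nh))))
    F≡ false ni = any-false (λ j → adj G i j ∧ z (inj₂ j)) (allFin L) silent
      where
      silent : ∀ j → adj G i j ∧ z (inj₂ j) ≡ false
      silent j with adj G i j in aij
      ... | false = refl
      ... | true  = begin
          z (inj₂ j)  ≡⟨ z∈ (inj₂ j) (outside-I-n-false⇒neighbour-outside-I Ii ni aij) ⟩
          x (inj₂ j)  ≡⟨ fixed-d fp j ⟩
          not (n j)   ≡⟨ cong not (n-false⇒neighbour-n-true fp ni aij) ⟩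
          false       ∎
        where open ≡-Reasoning

  module _ {y : State L} {D : CSubset L} (trap : IsTrapSpace G y D) (H-in : (x , doubled H) ⊆ₛ (y , D)) where

    x∈ : x ∈[ y , D ]
    x∈ = H-in x (λ _ _ → refl)

    doubled-K⊆D : doubled K ⊆ᵇ D
    doubled-K⊆D = doubled-⊆ᵇ {A = K} λ k kk → trap-active-n G trap z∈ (moves kk) (coupled kk)
      where
      z = setᵈ x H₁ true
      z∈ : z ∈[ y , D ]
      z∈ = H-in z (setᵈ-∈ x H₁ true H₁⊆H)
      moves : ∀ {k} → K k ≡ true → F G z (inj₁ k) ≢ z (inj₁ k)
      moves {k} kk
        with s , _ , nk ← K⁻ kk
        with h , h₁∧ahk ← any-witness (λ h → H₁ h ∧ adj G h k) (allFin L) s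
        with h₁ , ahk ← ∧-true⁻ h₁∧ahk
        = λ frozen → not-¬ (trans (sym frozen) F≡true) nk
        where
        F≡true = any-intro (λ j → adj G k j ∧ z (inj₂ j)) (∈-allFin h)
                           (∧-true⁺ (trans (symmetric G k h) ahk) (setᵈ-inside x H₁ true h₁))
      coupled : ∀ {k} → K k ≡ true → z (inj₂ k) ≡ not (z (inj₁ k))
      coupled {k} kk = trans (setᵈ-outside x H₁ true (⊆ᵇ-false H₁⊆H (proj₁ (proj₂ (K⁻ kk))))) (fixed-d fp k)

    doubled-J⊆D : doubled (H ∪ K) ⊆ᵇ D → doubled J ⊆ᵇ D
    doubled-J⊆D H∪K⊆D = doubled-⊆ᵇ {A = J} λ j jj → trap-active-n G trap z∈ (moves jj) (coupled jj)
      where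
      z = setᵈ x KH₀ false
      z∈ : z ∈[ y , D ]
      z∈ = ⊆ᵇ⇒⊆ₛ x∈ H∪K⊆D z (setᵈ-∈ x KH₀ false KH₀⊆H∪K)
      moves : ∀ {j} → J j ≡ true → F G z (inj₁ j) ≢ z (inj₁ j)
      moves {j} jj frozen = not-¬ (J⇒n-true jj) (trans (sym frozen) F≡false)
        where
        silent : ∀ h → adj G j h ∧ z (inj₂ h) ≡ false
        silent h with adj G j h in ajh
        ... | false = refl
        ... | true with J-condition⁻ (all-elim (J-condition j) (∈-allFin h) (proj₂ (proj₂ (J⁻ jj)))) ajh
        ... | inj₁ kh = setᵈ-inside x KH₀ false kh
        ... | inj₂ nh = trans (setᵈ-outside x KH₀ false (n-true⇒¬KH₀ nh)) (trans (fixed-d fp h) (cong not nh))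
        F≡false = any-false (λ h → adj G j h ∧ z (inj₂ h)) (allFin L) silent
      coupled : ∀ {j} → J j ≡ true → z (inj₂ j) ≡ not (z (inj₁ j))
      coupled {j} jj = trans (setᵈ-outside x KH₀ false (n-true⇒¬KH₀ (J⇒n-true jj))) (fixed-d fp j)

    I-minimal : (x , doubled I) ⊆ₛ (y , D)
    I-minimal = ⊆ᵇ⇒⊆ₛ x∈ (doubled-∪-⊆ᵇ doubled-H⊆D (doubled-∪-⊆ᵇ doubled-K⊆D (doubled-J⊆D doubled-H∪K⊆D)))
      where
      doubled-H⊆D : doubled H ⊆ᵇ D
      doubled-H⊆D = ⊆ₛ⇒⊆ᵇ H-in
      doubled-H∪K⊆D : doubled (H ∪ K) ⊆ᵇ D
      doubled-H∪K⊆D = doubled-∪-⊆ᵇ doubled-H⊆D doubled-K⊆D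

proposition4 : (L : ℕ) → 1 ≤ L → (G : Graph L) → (x : State L) → IsFixedPoint G x → (H : Subset L) →
    IsTrapSpace G x (doubled (Construction.I G x H))
    × ((x , doubled H) ⊆ₛ (x , doubled (Construction.I G x H)))
    × (∀ (y : State L) (I' : CSubset L) → IsTrapSpace G y I' → ((x , doubled H) ⊆ₛ (y , I')) →
         ((x , doubled (Construction.I G x H)) ⊆ₛ (y , I')))
proposition4 L _ G x fp H =
  frozen⇒trap G (I-frozen fp H) ,
  ⊆ᵇ⇒⊆ₛ (λ _ _ → refl) (doubled-⊆ᵇ λ i Hi → H⊆I fp H i Hi , H⊆I fp H i Hi) ,
  λ y I' trap H-in → I-minimal fp H trap H-in
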